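{- Up to isomorphism, the ladder SD-trees are exactly the SD-trees having exactly one $S$-node; that is, an SD-tree (with at least two leaves) has exactly one $S$-node if and only if it is isomorphic to the ladder SD-tree with the same number of leaves.
   Context: A summation tree is a rooted full binary tree (every node has $0$ or $2$ children). Two summation trees are isomorphic if one can be obtained from the other by a finite sequence of swaps of the two children (with their subtrees) of internal nodes. An SD-tree is a summation tree in which each internal node is labelled $S$ ($S$-node) if its two children have the same number of descendant leaves, and $D$ otherwise. The ladder SD-tree with $n\ge 2$ leaves is the tree of $((\cdots((x_1+x_2)+x_3)+\cdots)+x_n)$: for $n=2$ a root with two leaf children, and for $n>2$ a root whose children are a single leaf and the ladder tree with $n-1$ leaves. -}

module Defs where

open import Data.Nat using (ℕ; zero; suc; _+_; _≤_)
open import Data.Bool using (Bool; true; false; if_then_else_)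
open import Relation.Nullary.Decidable using (⌊_⌋)
open import Data.Nat using (_≟_)
open import Relation.Binary.Construct.Closure.ReflexiveTransitive using (Star)

data Tree : Set where
  leaf : Tree
  node : Tree → Tree → Tree

leaves : Tree → ℕ
leaves leaf       = 1
leaves (node l r) = leaves l + leaves r

data Swap : Tree → Tree → Set where
  here  : ∀ l r → Swap (node l r) (node r l)
  left  : ∀ {l l′} r → Swap l l′ → Swap (node l r) (node l′ r)
  right : ∀ l {r r′} → Swap r r′ → Swap (node l r) (node l r′)

_≅_ : Tree → Tree → Set
_≅_ = Star Swap

-- The labelling is determined by
-- the tree, so an SD-tree is a summation tree with this labelling.
isS : Tree → Bool
isS leaf       = false
isS (node l r) = ⌊ leaves l ≟ leaves r ⌋

#S : Tree → ℕ
#S leaf           = 0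
#S (node l r) = (if isS (node l r) then 1 else 0) + #S l + #S r

-- ladder tree with (n + 2) leaves: ((…((x₁+x₂)+x₃)+…)+x_{n+2});
-- root's children are the ladder with n+1 leaves and a single leaf.
ladder′ : ℕ → Tree
ladder′ zero    = node leaf leaf
ladder′ (suc n) = node (ladder′ n) leaf

module Submission where

-- A D-node with exactly one S-node below it has one child without S-nodes, and a
-- tree without S-nodes is a single leaf (a lowest internal node has two leaf
-- children and is an S-node). So a tree with
-- one S-node is, after swapping children, a leaf attached to a smaller tree with
-- one S-node, ending in node leaf leaf: a ladder. Conversely swaps preserve the
-- number of leaves below every node, hence the S/D labelling and #S.

open import Defs
open import Data.Nat using (ℕ; _+_; _≤_)
open import Data.Product using (_×_)
open import Relation.Binary.PropositionalEquality using (_≡_)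

open import Data.Nat using (zero; suc; _≟_)
open import Data.Nat.Properties using (+-comm; +-assoc; +-cancelʳ-≡; m+n≡0⇒m≡0; m+n≡0⇒n≡0; suc-injective)
open import Data.Bool using (Bool; if_then_else_)
open import Data.Product using (_,_; ∃-syntax)
open import Data.Sum using (_⊎_; inj₁; inj₂)
open import Data.Empty using (⊥-elim)
open import Relation.Nullary using (yes; no)
open import Relation.Binary.PropositionalEquality using (refl; sym; trans; cong; subst; module ≡-Reasoning)
open import Relation.Binary.Construct.Closure.ReflexiveTransitive using (ε; _◅_; gmap; fold)

node-congˡ : ∀ {l l′} r → l ≅ l′ → node l r ≅ node l′ r
node-congˡ r = gmap (λ l → node l r) (left r)

≅-invariant : {A : Set} (f : Tree → A) → (∀ {t u} → Swap t u → f t ≡ f u) →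
              ∀ {t u} → t ≅ u → f t ≡ f u
≅-invariant f swap-invariant = fold (λ t u → f t ≡ f u) (λ s → trans (swap-invariant s)) refl

leaves-swap : ∀ {t u} → Swap t u → leaves t ≡ leaves u
leaves-swap (here l r)  = +-comm (leaves l) (leaves r)
leaves-swap (left r s)  = cong (_+ leaves r) (leaves-swap s)
leaves-swap (right l s) = cong (leaves l +_) (leaves-swap s)

isS-swap : ∀ l r → isS (node l r) ≡ isS (node r l)
isS-swap l r with leaves l ≟ leaves r | leaves r ≟ leaves l
... | yes _ | yes _ = refl
... | no  _ | no  _ = refl
... | yes p | no ¬q = ⊥-elim (¬q (sym p))
... | no ¬p | yes q = ⊥-elim (¬p (sym q))

#S-swap : ∀ {t u} → Swap t u → #S t ≡ #S u
#S-swap (here l r) = begin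
  indicator (isS (node l r)) + #S l + #S r   ≡⟨ +-assoc (indicator (isS (node l r))) (#S l) (#S r) ⟩
  indicator (isS (node l r)) + (#S l + #S r) ≡⟨ cong (_+ (#S l + #S r)) (cong indicator (isS-swap l r)) ⟩
  indicator (isS (node r l)) + (#S l + #S r) ≡⟨ cong (indicator (isS (node r l)) +_) (+-comm (#S l) (#S r)) ⟩
  indicator (isS (node r l)) + (#S r + #S l) ≡⟨ sym (+-assoc (indicator (isS (node r l))) (#S r) (#S l)) ⟩
  indicator (isS (node r l)) + #S r + #S l   ∎
  where
  open ≡-Reasoning
  indicator : Bool → ℕ
  indicator b = if b then 1 else 0
#S-swap (left r s)  rewrite leaves-swap s | #S-swap s = refl
#S-swap (right l s) rewrite leaves-swap s | #S-swap s = refl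

leaves-ladder′ : ∀ n → leaves (ladder′ n) ≡ n + 2
leaves-ladder′ zero    = refl
leaves-ladder′ (suc n) = trans (cong (_+ 1) (leaves-ladder′ n)) (+-comm (n + 2) 1)

#S-ladder′ : ∀ n → #S (ladder′ n) ≡ 1
#S-ladder′ zero = refl
#S-ladder′ (suc n) rewrite leaves-ladder′ n | +-comm n 2 | #S-ladder′ n = refl

m+n≡1-split : ∀ m n → m + n ≡ 1 → (m ≡ 0 × n ≡ 1) ⊎ (m ≡ 1 × n ≡ 0)
m+n≡1-split zero          n    m+n≡1 = inj₁ (refl , m+n≡1)
m+n≡1-split (suc zero)    zero _     = inj₂ (refl , refl)
m+n≡1-split (suc zero)    (suc n) ()
m+n≡1-split (suc (suc m)) n ()

#S≡0⇒≡leaf : ∀ t → #S t ≡ 0 → t ≡ leaf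
#S≡0⇒≡leaf leaf _ = refl
#S≡0⇒≡leaf (node l r) #S≡0 with leaves l ≟ leaves r
... | yes _ with () ← #S≡0
... | no ¬same
  with refl ← #S≡0⇒≡leaf l (m+n≡0⇒m≡0 (#S l) #S≡0)
     | refl ← #S≡0⇒≡leaf r (m+n≡0⇒n≡0 (#S l) #S≡0)
  = ⊥-elim (¬same refl)

#S≡1⇒≅ladder′ : ∀ t → #S t ≡ 1 → ∃[ m ] t ≅ ladder′ m
#S≡1⇒≅ladder′ leaf ()
#S≡1⇒≅ladder′ (node l r) #S≡1 with leaves l ≟ leaves r
... | yes _
  with refl ← #S≡0⇒≡leaf l (m+n≡0⇒m≡0 (#S l) (suc-injective #S≡1))
     | refl ← #S≡0⇒≡leaf r (m+n≡0⇒n≡0 (#S l) (suc-injective #S≡1))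
  = 0 , ε
... | no _ with m+n≡1-split (#S l) (#S r) #S≡1
...   | inj₁ (#Sl≡0 , #Sr≡1) with refl ← #S≡0⇒≡leaf l #Sl≡0 =
  let m , r≅ladder = #S≡1⇒≅ladder′ r #Sr≡1
  in suc m , here leaf r ◅ node-congˡ leaf r≅ladder
...   | inj₂ (#Sl≡1 , #Sr≡0) with refl ← #S≡0⇒≡leaf r #Sr≡0 =
  let m , l≅ladder = #S≡1⇒≅ladder′ l #Sl≡1
  in suc m , node-congˡ leaf l≅ladder

corollary7 : (n : ℕ) (t : Tree) → leaves t ≡ n + 2 →
    (#S t ≡ 1 → t ≅ ladder′ n) × (t ≅ ladder′ n → #S t ≡ 1)
corollary7 n t leaves≡ = one-S⇒≅ladder′ , ≅ladder′⇒one-S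
  where
  ≅ladder′⇒one-S : t ≅ ladder′ n → #S t ≡ 1
  ≅ladder′⇒one-S t≅ladder = trans (≅-invariant #S #S-swap t≅ladder) (#S-ladder′ n)

  one-S⇒≅ladder′ : #S t ≡ 1 → t ≅ ladder′ n
  one-S⇒≅ladder′ #S≡1 with m , t≅ladder ← #S≡1⇒≅ladder′ t #S≡1 =
    subst (λ k → t ≅ ladder′ k) m≡n t≅ladder
    where
    m≡n : m ≡ n
    m≡n = +-cancelʳ-≡ 2 m n
      (trans (sym (trans (≅-invariant leaves leaves-swap t≅ladder) (leaves-ladder′ m))) leaves≡)
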